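{- Let $t \ge 3$ be an integer, and let $D$ be a digraph admitting a $\vec{C}_t$-factorization. Let $s \ge 3$ be an odd integer and $\ell$ a non-negative integer. Then: (a) the digraph $D \wr \bar{K}_s$ admits a $\vec{C}_t$-factorization; (b) the digraph $D \wr \bar{K}_s$ admits a $\vec{C}_{st}$-factorization; (c) if $t$ is odd, then the digraph $D \wr \bar{K}_{4^\ell s}$ admits a $\vec{C}_t$-factorization.
   Context: All digraphs are strict. $\vec{C}_k$ is the directed cycle of length $k$ and $\bar{K}_s$ is the empty graph on $s$ vertices. The wreath product $D_1 \wr D_2$ of digraphs has vertex set $V(D_1)\times V(D_2)$ and arc set consisting of all arcs $((u_1,u_2),(u_1,v_2))$ with $(u_2,v_2)\in A(D_2)$ and all arcs $((u_1,u_2),(v_1,v_2))$ with $(u_1,v_1)\in A(D_1)$. A $\vec{C}_k$-factor of a digraph $D$ is a spanning subdigraph that is a disjoint union of directed $k$-cycles; a $\vec{C}_k$-factorization of $D$ is a set of $\vec{C}_k$-factors whose arc sets partition $A(D)$. -}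

module Defs where

open import Data.Nat using (ℕ; zero; suc; _<_)
open import Data.Fin using (Fin; _≟_)
open import Data.Bool using (Bool; true; false; _∧_; _∨_; T)
open import Data.Bool.Properties using (∨-identityʳ)
open import Data.Product using (Σ; _×_; _,_)
open import Relation.Nullary using (¬_; does; yes; no)
open import Relation.Binary.PropositionalEquality using (_≡_; refl; trans)
open import Function using (_∘_)

-- A strict digraph on vertex set V: a Bool-valued arc relation
-- (so at most one arc u→v; antiparallel arcs allowed) without loops.
record Digraph (V : Set) : Set where
  field
    arc      : V → V → Bool
    loopless : ∀ v → arc v v ≡ false
open Digraph public

iterate : {V : Set} → (V → V) → ℕ → V → V
iterate f zero    x = x
iterate f (suc j) x = f (iterate f j x)

-- A directed C_k-factor of D: a spanning subdigraph that is a disjoint union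
-- of directed k-cycles.  It is given by its successor map `next`
-- (the factor's arcs are exactly v → next v); `next` is a bijection
-- (every vertex has in- and out-degree 1), every arc lies in D, and every
-- vertex lies on a directed cycle of length exactly k.
record CkFactor {V : Set} (k : ℕ) (D : Digraph V) : Set where
  field
    next      : V → V
    prev      : V → V
    next-prev : ∀ v → next (prev v) ≡ v
    prev-next : ∀ v → prev (next v) ≡ v
    inD       : ∀ v → arc D v (next v) ≡ true
    period    : ∀ v → iterate next k v ≡ v
    minimal   : ∀ v (j : ℕ) → 0 < j → j < k → ¬ (iterate next j v ≡ v)
open CkFactor public

-- A C_k-factorization of D: a finite family of C_k-factors whose arc sets
-- partition A(D): every arc of D lies in exactly one factor (and factor
-- arcs are arcs of D by `inD`).
CkFactorization : {V : Set} → ℕ → Digraph V → Set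
CkFactorization {V} k D =
  Σ ℕ λ r → Σ (Fin r → CkFactor k D) λ F →
    ∀ (u v : V) → arc D u v ≡ true →
      Σ (Fin r) λ i → (next (F i) u ≡ v) × (∀ j → next (F j) u ≡ v → j ≡ i)

K̄ : (s : ℕ) → Digraph (Fin s)
K̄ s = record { arc = λ _ _ → false ; loopless = λ _ → refl }

wreathArc : {n m : ℕ} → Digraph (Fin n) → Digraph (Fin m) →
            Fin n × Fin m → Fin n × Fin m → Bool
wreathArc D₁ D₂ (u₁ , u₂) (v₁ , v₂) =
  (does (u₁ ≟ v₁) ∧ arc D₂ u₂ v₂) ∨ arc D₁ u₁ v₁

wreath-loopless : {n m : ℕ} (D₁ : Digraph (Fin n)) (D₂ : Digraph (Fin m)) →
                  ∀ v → wreathArc D₁ D₂ v v ≡ false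
wreath-loopless D₁ D₂ (u₁ , u₂) with u₁ ≟ u₁
... | yes _ rewrite loopless D₂ u₂ | loopless D₁ u₁ = refl
... | no _  rewrite loopless D₁ u₁ = refl

_≀_ : {n m : ℕ} → Digraph (Fin n) → Digraph (Fin m) → Digraph (Fin n × Fin m)
D₁ ≀ D₂ = record { arc = wreathArc D₁ D₂ ; loopless = wreath-loopless D₁ D₂ }

-- Fix a C_t-factor F of D and number each of its cycles from its least vertex, giving every u a
-- phase in 0, …, t - 1.  Let G be an abelian group of order m with permutations φ₀, …, φ_{t-1}
-- whose values at every x add up to a constant g of order p.  For each key x ∈ G the map
-- (u , a) ↦ (next u , a + φ_{phase u} x) is a C_{pt}-factor of D ≀ K̄_m: subtracting the partial
-- sum φ₀ x + ⋯ + φ_{phase u - 1} x from the second coordinate conjugates it to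
-- (u , y) ↦ (next u , y + [u closes its cycle] g), whose cycles visibly have length p t.  An arc
-- (u , a) → (next u , b) lies only in the factor with key φ_{phase u}⁻¹ (b - a), so over all
-- factors F and keys x these maps partition the arcs of D ≀ K̄_m.
-- For odd s, ℤ_s carries such families with g = 0 (x, -x, x, -x, …, preceded by x, x, -2x when t
-- is odd) and, translating φ₀ by 1, with g = 1 of order s; for odd t the Klein group 𝔽₄ carries
-- x, ω x, ω² x, x, -x, …, and families multiply over products of groups.

module Submission where

open import Defs
open import Data.Nat as ℕ
  using (ℕ; zero; suc; _+_; _*_; _∸_; _^_; _≤_; _<_; _%_; _/_; NonZero; pred; z≤n; s≤s; z<s; >-nonZero⁻¹)
open import Data.Nat.Properties
  using (+-comm; +-assoc; +-suc; +-identityʳ; +-cancelʳ-≡; *-comm; *-identityʳ; *-distribʳ-+;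
         *-cancelʳ-≡; *-cancelʳ-<; <-cmp; <-irrefl; <⇒≤; ≤-antisym; ≤-<-trans; m≤n⇒m<n∨m≡n;
         m<n⇒0<n∸m; m∸n≤m; m∸n+n≡m; m+[n∸m]≡n; suc-pred; ≤-totalOrder; module ≤-Reasoning)
open import Data.Nat.DivMod
  using (_mod_; m≡m%n+[m/n]*n; m%n<n; m<n⇒m%n≡m; m<n⇒m/n≡0; n%n≡0; n/n≡1; %-distribˡ-+;
         [m+n]%n≡m%n; [m+kn]%n≡m%n)
open import Data.Nat.Divisibility using (_∣_; divides)
open import Data.Fin as Fin using (Fin; toℕ; combine; remQuot)
open import Data.Fin.Patterns using (0F; 1F)
open import Data.Fin.Properties
  using (toℕ-injective; toℕ-fromℕ; toℕ-fromℕ<; toℕ-inject₁; toℕ<n; remQuot-combine; combine-remQuot; *↔×)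
open import Data.Bool using (true; _∨_)
open import Data.Bool.Properties using (∧-zeroʳ)
open import Data.List using (upTo)
open import Data.List.Membership.Propositional.Properties using (∈-upTo⁺; ∈-upTo⁻)
open import Data.List.Relation.Unary.All as All using (All)
import Data.List.Extrema ≤-totalOrder as Extrema
open import Data.Product using (Σ; _×_; _,_; proj₁; proj₂; ∃!; uncurry; zip)
open import Data.Product.Function.NonDependent.Propositional using (_×-↔_)
open import Data.Product.Relation.Binary.Pointwise.NonDependent using (≡×≡⇒≡; ≡⇒≡×≡)
open import Data.Sum using (inj₁; inj₂)
open import Data.Empty using (⊥; ⊥-elim)
open import Level using (0ℓ)
open import Algebra.Bundles using (AbelianGroup)
open import Algebra.Core using (Op₁; Op₂)
open import Algebra.Structures using (IsAbelianGroup)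
import Algebra.Consequences.Setoid as Consequences
import Algebra.Construct.DirectProduct as DirectProduct
import Algebra.Construct.Subst.Equality as SubstEquality
import Algebra.Properties.AbelianGroup as AbelianGroupProperties
import Algebra.Properties.CommutativeMonoid.Mult as CommutativeMonoidMult
import Algebra.Properties.Monoid.Mult as MonoidMult
import Algebra.Properties.Monoid.Sum as MonoidSum
open import Function.Base using (_∘_)
open import Function.Bundles using (_↔_; Inverse; mk↔ₛ′)
open import Function.Properties.Inverse using (↔-refl; ↔-sym; ↔-trans)
open import Relation.Nullary using (¬_; does)
open import Relation.Binary.Definitions using (tri<; tri≈; tri>)
open import Relation.Binary.PropositionalEquality hiding ([_])

module _ {A : Set} (f : A → A) where

  iterate-+ : ∀ i j x → iterate f (i + j) x ≡ iterate f i (iterate f j x)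
  iterate-+ zero    j x = refl
  iterate-+ (suc i) j x = cong f (iterate-+ i j x)

  iterate-suc : ∀ j x → iterate f j (f x) ≡ iterate f (suc j) x
  iterate-suc zero    x = refl
  iterate-suc (suc j) x = cong f (iterate-suc j x)

  module _ {t : ℕ} (period : ∀ x → iterate f t x ≡ x) where

    iterate-* : ∀ q x → iterate f (q * t) x ≡ x
    iterate-* zero    x = refl
    iterate-* (suc q) x = begin
      iterate f (t + q * t) x            ≡⟨ iterate-+ t (q * t) x ⟩
      iterate f t (iterate f (q * t) x)  ≡⟨ cong (iterate f t) (iterate-* q x) ⟩
      iterate f t x                      ≡⟨ period x ⟩
      x                                  ∎
      where open ≡-Reasoning

    iterate-% : .{{_ : NonZero t}} → ∀ j x → iterate f (j % t) x ≡ iterate f j x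
    iterate-% j x = begin
      iterate f (j % t) x                          ≡⟨ cong (iterate f (j % t)) (iterate-* (j / t) x) ⟨
      iterate f (j % t) (iterate f (j / t * t) x)  ≡⟨ iterate-+ (j % t) (j / t * t) x ⟨
      iterate f (j % t + j / t * t) x              ≡⟨ cong (λ i → iterate f i x) (m≡m%n+[m/n]*n j t) ⟨
      iterate f j x                                ∎
      where open ≡-Reasoning

iterate-inverse : {A : Set} (f g : A → A) → (∀ x → g (f x) ≡ x) →
                  ∀ j x → iterate g j (iterate f j x) ≡ x
iterate-inverse f g gf zero    x = refl
iterate-inverse f g gf (suc j) x =
  trans (sym (iterate-suc g j _)) (trans (cong (iterate g j) (gf _)) (iterate-inverse f g gf j x))

-- Phases on the cycles of a factor

module Cycles {t n : ℕ} .{{_ : NonZero t}} {D : Digraph (Fin n)} (F : CkFactor t D) where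

  itN itP : ℕ → Fin n → Fin n
  itN = iterate (next F)
  itP = iterate (prev F)

  itP-period : ∀ u → itP t u ≡ u
  itP-period u = trans (cong (itP t) (sym (period F u))) (iterate-inverse (next F) (prev F) (prev-next F) t u)

  itP-% : ∀ j u → itP (j % t) u ≡ itP j u
  itP-% = iterate-% (prev F) itP-period

  itN-% : ∀ j u → itN (j % t) u ≡ itN j u
  itN-% = iterate-% (next F) (period F)

  itN-fixed⇒%≡0 : ∀ {j u} → itN j u ≡ u → j % t ≡ 0
  itN-fixed⇒%≡0 {j} {u} fixed with j % t in eq
  ... | zero  = refl
  ... | suc r = ⊥-elim (minimal F u (suc r) z<s (subst (_< t) eq (m%n<n j t))
                  (trans (sym (cong (λ i → itN i u) eq)) (trans (itN-% j u) fixed)))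

  itP-distinct : ∀ {i j u} → i < j → j < t → itP i u ≢ itP j u
  itP-distinct {i} {j} {u} i<j j<t same =
    minimal F u (j ∸ i) (m<n⇒0<n∸m i<j) (≤-<-trans (m∸n≤m j i) j<t) (begin
      itN (j ∸ i) u                  ≡⟨ cong (itN (j ∸ i)) (iterate-inverse (prev F) (next F) (next-prev F) i u) ⟨
      itN (j ∸ i) (itN i (itP i u))  ≡⟨ iterate-+ (next F) (j ∸ i) i (itP i u) ⟨
      itN (j ∸ i + i) (itP i u)      ≡⟨ cong₂ itN (m∸n+n≡m (<⇒≤ i<j)) same ⟩
      itN j (itP j u)                ≡⟨ iterate-inverse (prev F) (next F) (next-prev F) j u ⟩
      u                              ∎)
    where open ≡-Reasoning

  itP-injective : ∀ {i j u} → i < t → j < t → itP i u ≡ itP j u → i ≡ j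
  itP-injective {i} {j} i<t j<t same with <-cmp i j
  ... | tri< i<j _ _ = ⊥-elim (itP-distinct i<j j<t same)
  ... | tri≈ _ i≡j _ = i≡j
  ... | tri> _ _ j<i = ⊥-elim (itP-distinct j<i i<t (sym same))

  itP-next : ∀ j u → itP (suc j) (next F u) ≡ itP j u
  itP-next j u = trans (sym (iterate-suc (prev F) j (next F u))) (cong (itP j) (prev-next F u))

  next≡itP : ∀ u → next F u ≡ itP (pred t) u
  next≡itP u = begin
    next F u                          ≡⟨ cong (next F) (trans (cong (λ i → itP i u) (suc-pred t)) (itP-period u)) ⟨
    next F (prev F (itP (pred t) u))  ≡⟨ next-prev F _ ⟩
    itP (pred t) u                    ∎
    where open ≡-Reasoning

  itP-of-next : ∀ i u → itP i (next F u) ≡ itP (i + pred t) u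
  itP-of-next i u = trans (cong (itP i) (next≡itP u)) (sym (iterate-+ (prev F) i (pred t) u))

  itN-* : ∀ q u → itN (q * t) u ≡ u
  itN-* = iterate-* (next F) (period F)

  height : Fin n → ℕ → ℕ
  height u i = toℕ (itP i u)

  -- u is phase u steps after the least vertex of its cycle.
  phase : Fin n → ℕ
  phase u = Extrema.argmin (height u) 0 (upTo t)

  phase<t : ∀ u → phase u < t
  phase<t u = Extrema.argmin-all (height u) {xs = upTo t} (>-nonZero⁻¹ t) (All.tabulate ∈-upTo⁻)

  phase-minimal : ∀ u {i} → i < t → height u (phase u) ≤ height u i
  phase-minimal u i<t = All.lookup (Extrema.f[argmin]≤f[xs] {f = height u} 0 (upTo t)) (∈-upTo⁺ i<t)

  phase-minimal′ : ∀ u i → height u (phase u) ≤ height u i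
  phase-minimal′ u i = subst (height u (phase u) ≤_) (cong toℕ (itP-% i u)) (phase-minimal u (m%n<n i t))

  phase-unique : ∀ {u j} → j < t → (∀ {i} → i < t → height u j ≤ height u i) → j ≡ phase u
  phase-unique {u} j<t j-minimal =
    itP-injective j<t (phase<t u) (toℕ-injective (≤-antisym (j-minimal (phase<t u)) (phase-minimal u j<t)))

  phase-next : ∀ u → phase (next F u) ≡ suc (phase u) % t
  phase-next u = sym (phase-unique (m%n<n (suc (phase u)) t) λ {i} _ → begin
    height (next F u) (suc (phase u) % t)  ≡⟨ cong toℕ (trans (itP-% _ _) (itP-next (phase u) u)) ⟩
    height u (phase u)                     ≤⟨ phase-minimal′ u (i + pred t) ⟩
    height u (i + pred t)                  ≡⟨ cong toℕ (itP-of-next i u) ⟨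
    height (next F u) i                    ∎)
    where open ≤-Reasoning

  -- 1 if next F u is the least vertex of its cycle, 0 otherwise.
  wraps : Fin n → ℕ
  wraps u = suc (phase u) / t

  wraps-phase-next : ∀ u → wraps u * t + phase (next F u) ≡ suc (phase u)
  wraps-phase-next u = begin
    s / t * t + phase (next F u)  ≡⟨ cong (s / t * t +_) (phase-next u) ⟩
    s / t * t + s % t             ≡⟨ +-comm (s / t * t) (s % t) ⟩
    s % t + s / t * t             ≡⟨ m≡m%n+[m/n]*n s t ⟨
    s                             ∎
    where
    s = suc (phase u)
    open ≡-Reasoning

  laps : ℕ → Fin n → ℕ
  laps zero    u = 0
  laps (suc j) u = laps j u + wraps (itN j u)

  laps-phase : ∀ j u → laps j u * t + phase (itN j u) ≡ j + phase u
  laps-phase zero    u = refl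
  laps-phase (suc j) u = begin
    (laps j u + wraps w) * t + phase (next F w)      ≡⟨ cong (_+ phase (next F w)) (*-distribʳ-+ t (laps j u) (wraps w)) ⟩
    laps j u * t + wraps w * t + phase (next F w)    ≡⟨ +-assoc (laps j u * t) _ _ ⟩
    laps j u * t + (wraps w * t + phase (next F w))  ≡⟨ cong (laps j u * t +_) (wraps-phase-next w) ⟩
    laps j u * t + suc (phase w)                     ≡⟨ +-suc _ _ ⟩
    suc (laps j u * t + phase w)                     ≡⟨ cong suc (laps-phase j u) ⟩
    suc (j + phase u)                                ∎
    where
    w = itN j u
    open ≡-Reasoning

  laps-* : ∀ q u → laps (q * t) u ≡ q
  laps-* q u = *-cancelʳ-≡ (laps (q * t) u) q t (+-cancelʳ-≡ (phase u) _ _ (begin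
    laps (q * t) u * t + phase u                ≡⟨ cong (λ v → laps (q * t) u * t + phase v) (itN-* q u) ⟨
    laps (q * t) u * t + phase (itN (q * t) u)  ≡⟨ laps-phase (q * t) u ⟩
    q * t + phase u                             ∎))
    where open ≡-Reasoning

-- Lifting factors to D ≀ K̄_m

record Semiregular (k : ℕ) (A : Set) : Set where
  field
    next      : A → A
    prev      : A → A
    next-prev : ∀ a → next (prev a) ≡ a
    prev-next : ∀ a → prev (next a) ≡ a
    period    : ∀ a → iterate next k a ≡ a
    minimal   : ∀ a j → 0 < j → j < k → iterate next j a ≢ a

module _ {k : ℕ} {A B : Set} (σ : B ↔ A) (π : Semiregular k B) where
  private
    module σ = Inverse σ
    module π = Semiregular π

  module _ (f : A → A) (f∘σ : ∀ b → f (σ.to b) ≡ σ.to (π.next b)) where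

    iterate-conjugate : ∀ j b → iterate f j (σ.to b) ≡ σ.to (iterate π.next j b)
    iterate-conjugate zero    b = refl
    iterate-conjugate (suc j) b = trans (cong f (iterate-conjugate j b)) (f∘σ _)

    conjugate : Semiregular k A
    conjugate = record
      { next      = f
      ; prev      = σ.to ∘ π.prev ∘ σ.from
      ; next-prev = λ a → trans (f∘σ _) (trans (cong σ.to (π.next-prev _)) (σ.strictlyInverseˡ a))
      ; prev-next = λ a → begin
          σ.to (π.prev (σ.from (f a)))                       ≡⟨ cong (σ.to ∘ π.prev ∘ σ.from ∘ f) (σ.strictlyInverseˡ a) ⟨
          σ.to (π.prev (σ.from (f (σ.to (σ.from a)))))       ≡⟨ cong (σ.to ∘ π.prev ∘ σ.from) (f∘σ (σ.from a)) ⟩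
          σ.to (π.prev (σ.from (σ.to (π.next (σ.from a)))))  ≡⟨ cong (σ.to ∘ π.prev) (σ.strictlyInverseʳ _) ⟩
          σ.to (π.prev (π.next (σ.from a)))                  ≡⟨ cong σ.to (π.prev-next _) ⟩
          σ.to (σ.from a)                                    ≡⟨ σ.strictlyInverseˡ a ⟩
          a                                                  ∎
      ; period    = λ a → begin
          iterate f k a                       ≡⟨ cong (iterate f k) (σ.strictlyInverseˡ a) ⟨
          iterate f k (σ.to (σ.from a))       ≡⟨ iterate-conjugate k (σ.from a) ⟩
          σ.to (iterate π.next k (σ.from a))  ≡⟨ cong σ.to (π.period _) ⟩
          σ.to (σ.from a)                     ≡⟨ σ.strictlyInverseˡ a ⟩
          a                                   ∎
      ; minimal   = λ a j 0<j j<k fixed → π.minimal (σ.from a) j 0<j j<k (begin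
          iterate π.next j (σ.from a)                  ≡⟨ σ.strictlyInverseʳ _ ⟨
          σ.from (σ.to (iterate π.next j (σ.from a)))  ≡⟨ cong σ.from (iterate-conjugate j (σ.from a)) ⟨
          σ.from (iterate f j (σ.to (σ.from a)))       ≡⟨ cong (σ.from ∘ iterate f j) (σ.strictlyInverseˡ a) ⟩
          σ.from (iterate f j a)                       ≡⟨ cong σ.from fixed ⟩
          σ.from a                                     ∎)
      }
      where open ≡-Reasoning

record FiniteAbelianGroup (m : ℕ) : Set₁ where
  infixl 7 _∙_
  infix 8 _⁻¹
  field
    Carrier        : Set
    _∙_            : Op₂ Carrier
    ε              : Carrier
    _⁻¹            : Op₁ Carrier
    isAbelianGroup : IsAbelianGroup _≡_ _∙_ ε _⁻¹
    enumeration    : Fin m ↔ Carrier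

  abelianGroup : AbelianGroup 0ℓ 0ℓ
  abelianGroup = record { isAbelianGroup = isAbelianGroup }

  open AbelianGroup abelianGroup public
    using (assoc; comm; identityˡ; identityʳ; inverseʳ; _-_; monoid; commutativeMonoid)
  open AbelianGroupProperties abelianGroup public
  open MonoidMult monoid public
    using (×-homo-+; ×-homo-1) renaming (_×_ to _·_)
  open CommutativeMonoidMult commutativeMonoid public
    using (×-distrib-+)
  open MonoidSum monoid public
    using (sum; sum-syntax; sum-init-last; sum-cong-≗)

module _ {m : ℕ} (G : FiniteAbelianGroup m) where
  open FiniteAbelianGroup G

  record HasOrder (g : Carrier) (p : ℕ) : Set where
    field
      p·g≡ε : p · g ≡ ε
      q·g≢ε : ∀ q → 0 < q → q < p → q · g ≢ ε

  record SumFamily (t : ℕ) (g : Carrier) : Set where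
    field
      perm     : ℕ → Carrier ↔ Carrier  -- only perm 0, …, perm (t ∸ 1) are constrained
      sum-perm : ∀ x → ∑[ i < t ] Inverse.to (perm (toℕ i)) x ≡ g

  ZeroSumFamily : ℕ → Set
  ZeroSumFamily t = SumFamily t ε

wreath-K̄-arc : ∀ {n m} (D : Digraph (Fin n)) u a v b → arc (D ≀ K̄ m) (u , a) (v , b) ≡ arc D u v
wreath-K̄-arc D u a v b = cong (_∨ arc D u v) (∧-zeroʳ (does (u Fin.≟ v)))

toCkFactor : ∀ {k} {V : Set} {D : Digraph V} (π : Semiregular k V) →
             (∀ v → arc D v (Semiregular.next π v) ≡ true) → CkFactor k D
toCkFactor π inD = record
  { next = π.next ; prev = π.prev ; next-prev = π.next-prev ; prev-next = π.prev-next
  ; inD = inD ; period = π.period ; minimal = π.minimal }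
  where
  module π = Semiregular π

record Lift {k t n m : ℕ} {D : Digraph (Fin n)} (F : CkFactor t D) : Set where
  field
    factor   : Fin m → CkFactor k (D ≀ K̄ m)
    over     : ∀ c u a → proj₁ (next (factor c) (u , a)) ≡ next F u
    covering : ∀ u a b → ∃! _≡_ λ c → next (factor c) (u , a) ≡ (next F u , b)

factorization-lift : ∀ {k t n m} {D : Digraph (Fin n)} → CkFactorization t D →
                     (∀ F → Lift {k} {m = m} F) → CkFactorization k (D ≀ K̄ m)
factorization-lift {k} {t} {n} {m} {D} (r , F , cover) lift = r * m , factorAt ∘ remQuot m , covered
  where
  factorAt : Fin r × Fin m → CkFactor k (D ≀ K̄ m)
  factorAt (i , c) = Lift.factor (lift (F i)) c

  covered : ∀ x y → arc (D ≀ K̄ m) x y ≡ true →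
            Σ (Fin (r * m)) λ ι → (next (factorAt (remQuot m ι)) x ≡ y)
                                × (∀ ι′ → next (factorAt (remQuot m ι′)) x ≡ y → ι′ ≡ ι)
  covered (u , a) (v , b) uv∈D≀K̄ = combine i c , at-combine , unique
    where
    D-cover = cover u v (trans (sym (wreath-K̄-arc D u a v b)) uv∈D≀K̄)
    i = proj₁ D-cover
    i-next = proj₁ (proj₂ D-cover)
    i-unique = proj₂ (proj₂ D-cover)
    c = proj₁ (Lift.covering (lift (F i)) u a b)
    c-next = proj₁ (proj₂ (Lift.covering (lift (F i)) u a b))
    c-unique = proj₂ (proj₂ (Lift.covering (lift (F i)) u a b))

    at-combine : next (factorAt (remQuot m (combine i c))) (u , a) ≡ (v , b)
    at-combine = trans (cong (λ ic → next (factorAt ic) (u , a)) (remQuot-combine i c))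
                       (trans c-next (cong (_, b) i-next))

    unique-at : ∀ i′ c′ → next (factorAt (i′ , c′)) (u , a) ≡ (v , b) → (i′ , c′) ≡ (i , c)
    unique-at i′ c′ h with i-unique i′ (trans (sym (Lift.over (lift (F i′)) c′ u a)) (cong proj₁ h))
    ... | refl = cong (i ,_) (sym (c-unique (trans h (cong (_, b) (sym i-next)))))

    unique : ∀ ι′ → next (factorAt (remQuot m ι′)) (u , a) ≡ (v , b) → ι′ ≡ combine i c
    unique ι′ h = trans (sym (combine-remQuot {r} m ι′)) (cong (uncurry combine) (unique-at _ _ h))

module Lifting {t n m : ℕ} .{{_ : NonZero t}} {D : Digraph (Fin n)} (F : CkFactor t D)
               (G : FiniteAbelianGroup m) {g : FiniteAbelianGroup.Carrier G} (family : SumFamily G t g) where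
  open Cycles F
  open FiniteAbelianGroup G
  open SumFamily family
  private
    module E = Inverse enumeration

  module Φ (i : ℕ) = Inverse (perm i)

  φ : ℕ → Carrier → Carrier
  φ = Φ.to

  shift : Fin n × Carrier → Fin n × Carrier
  shift (u , y) = next F u , y ∙ wraps u · g

  iterate-shift : ∀ j u y → iterate shift j (u , y) ≡ (itN j u , y ∙ laps j u · g)
  iterate-shift zero    u y = cong (u ,_) (sym (identityʳ y))
  iterate-shift (suc j) u y = begin
    shift (iterate shift j (u , y))              ≡⟨ cong shift (iterate-shift j u y) ⟩
    next F w , (y ∙ laps j u · g) ∙ wraps w · g  ≡⟨ cong (next F w ,_) (assoc y _ _) ⟩
    next F w , y ∙ (laps j u · g ∙ wraps w · g)  ≡⟨ cong (λ z → next F w , y ∙ z) (×-homo-+ g (laps j u) (wraps w)) ⟨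
    next F w , y ∙ laps (suc j) u · g            ∎
    where
    w = itN j u
    open ≡-Reasoning

  shift-fixed : ∀ {j u y} → iterate shift j (u , y) ≡ (u , y) → Σ ℕ λ q → j ≡ q * t × q · g ≡ ε
  shift-fixed {j} {u} {y} fixed = j / t , j≡q*t , (begin
    (j / t) · g             ≡⟨ cong (_· g) (laps-* (j / t) u) ⟨
    laps (j / t * t) u · g  ≡⟨ cong (λ i → laps i u · g) j≡q*t ⟨
    laps j u · g            ≡⟨ identityʳ-unique y _ (cong proj₂ (trans (sym (iterate-shift j u y)) fixed)) ⟩
    ε                       ∎)
    where
    open ≡-Reasoning
    j≡q*t : j ≡ j / t * t
    j≡q*t = trans (m≡m%n+[m/n]*n j t)
              (cong (_+ j / t * t) (itN-fixed⇒%≡0 (cong proj₁ (trans (sym (iterate-shift j u y)) fixed))))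

  shiftSemiregular : ∀ {p} → HasOrder G g p → Semiregular (p * t) (Fin n × Carrier)
  shiftSemiregular {p} order = record
    { next      = shift
    ; prev      = λ (u , y) → prev F u , y - wraps (prev F u) · g
    ; next-prev = λ (u , y) → cong₂ _,_ (next-prev F u) (//-rightDividesˡ _ y)
    ; prev-next = λ (u , y) → cong₂ _,_ (prev-next F u)
                    (trans (cong (λ v → y ∙ wraps u · g - wraps v · g) (prev-next F u)) (//-rightDividesʳ _ y))
    ; period    = λ (u , y) → begin
        iterate shift (p * t) (u , y)           ≡⟨ iterate-shift (p * t) u y ⟩
        itN (p * t) u , y ∙ laps (p * t) u · g  ≡⟨ cong₂ (λ v q → v , y ∙ q · g) (itN-* p u) (laps-* p u) ⟩
        u , y ∙ p · g                           ≡⟨ cong (λ z → u , y ∙ z) (HasOrder.p·g≡ε order) ⟩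
        u , y ∙ ε                               ≡⟨ cong (u ,_) (identityʳ y) ⟩
        u , y                                   ∎
    ; minimal   = λ (u , y) j 0<j j<p*t fixed → below-order 0<j j<p*t (shift-fixed fixed)
    }
    where
    open ≡-Reasoning
    below-order : ∀ {j} → 0 < j → j < p * t → Σ ℕ (λ q → j ≡ q * t × q · g ≡ ε) → ⊥
    below-order 0<j j<p*t (q , refl , q·g≡ε) =
      HasOrder.q·g≢ε order q (*-cancelʳ-< t 0 q 0<j) (*-cancelʳ-< t q p j<p*t) q·g≡ε

  prefix : Carrier → ℕ → Carrier
  prefix x k = ∑[ i < k ] φ (toℕ i) x

  prefix-suc : ∀ x k → prefix x (suc k) ≡ prefix x k ∙ φ k x
  prefix-suc x k = trans (sum-init-last (λ i → φ (toℕ i) x))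
    (cong₂ _∙_ (sum-cong-≗ {k} (λ i → cong (λ j → φ j x) (toℕ-inject₁ i))) (cong (λ j → φ j x) (toℕ-fromℕ k)))

  prefix-wrap : ∀ x {k} → k ≤ t → prefix x k ≡ prefix x (k % t) ∙ (k / t) · g
  prefix-wrap x {k} k≤t with m≤n⇒m<n∨m≡n k≤t
  ... | inj₁ k<t = begin
    prefix x k                      ≡⟨ identityʳ _ ⟨
    prefix x k ∙ 0 · g              ≡⟨ cong₂ (λ j q → prefix x j ∙ q · g) (m<n⇒m%n≡m k<t) (m<n⇒m/n≡0 k<t) ⟨
    prefix x (k % t) ∙ (k / t) · g  ∎
    where open ≡-Reasoning
  ... | inj₂ refl = begin
    prefix x t                      ≡⟨ sum-perm x ⟩
    g                               ≡⟨ trans (identityˡ (1 · g)) (×-homo-1 g) ⟨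
    prefix x 0 ∙ 1 · g              ≡⟨ cong₂ (λ j q → prefix x j ∙ q · g) (n%n≡0 t) (n/n≡1 t) ⟨
    prefix x (t % t) ∙ (t / t) · g  ∎
    where open ≡-Reasoning

  potential : Carrier → Fin n → Carrier
  potential x u = prefix x (phase u)

  potential-next : ∀ x u → potential x (next F u) ∙ wraps u · g ≡ potential x u ∙ φ (phase u) x
  potential-next x u = begin
    potential x (next F u) ∙ wraps u · g        ≡⟨ cong (λ j → prefix x j ∙ wraps u · g) (phase-next u) ⟩
    prefix x (suc (phase u) % t) ∙ wraps u · g  ≡⟨ prefix-wrap x (phase<t u) ⟨
    prefix x (suc (phase u))                    ≡⟨ prefix-suc x (phase u) ⟩
    potential x u ∙ φ (phase u) x               ∎
    where open ≡-Reasoning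

  lifted : Carrier → Fin n × Fin m → Fin n × Fin m
  lifted x (u , a) = next F u , E.from (E.to a ∙ φ (phase u) x)

  conjugator : Carrier → (Fin n × Carrier) ↔ (Fin n × Fin m)
  conjugator x = mk↔ₛ′
    (λ (u , y) → u , E.from (y ∙ potential x u))
    (λ (u , a) → u , E.to a - potential x u)
    (λ (u , a) → cong (u ,_) (trans (cong E.from (//-rightDividesˡ _ (E.to a))) (E.strictlyInverseʳ a)))
    (λ (u , y) → cong (u ,_) (trans (cong (_- potential x u) (E.strictlyInverseˡ _)) (//-rightDividesʳ _ y)))

  lifted-conjugator : ∀ x b → lifted x (Inverse.to (conjugator x) b) ≡ Inverse.to (conjugator x) (shift b)
  lifted-conjugator x (u , y) = cong (next F u ,_) (cong E.from (begin
    E.to (E.from (y ∙ Q u)) ∙ φ (phase u) x  ≡⟨ cong (_∙ φ (phase u) x) (E.strictlyInverseˡ _) ⟩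
    y ∙ Q u ∙ φ (phase u) x                  ≡⟨ assoc y _ _ ⟩
    y ∙ (Q u ∙ φ (phase u) x)                ≡⟨ cong (y ∙_) (potential-next x u) ⟨
    y ∙ (Q (next F u) ∙ wraps u · g)         ≡⟨ cong (y ∙_) (comm _ _) ⟩
    y ∙ (wraps u · g ∙ Q (next F u))         ≡⟨ assoc y _ _ ⟨
    y ∙ wraps u · g ∙ Q (next F u)           ∎))
    where
    Q = potential x
    open ≡-Reasoning

  module _ {p : ℕ} (order : HasOrder G g p) where

    liftedFactor : Carrier → CkFactor (p * t) (D ≀ K̄ m)
    liftedFactor x = toCkFactor (conjugate (conjugator x) (shiftSemiregular order) (lifted x) (lifted-conjugator x))
      λ (u , a) → trans (wreath-K̄-arc D u a (next F u) (proj₂ (lifted x (u , a)))) (inD F u)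

    lift : Lift {p * t} F
    lift = record
      { factor   = liftedFactor ∘ E.to
      ; over     = λ _ _ _ → refl
      ; covering = λ u a b → E.from (key u a b) , covers u a b , unique u a b
      }
      where
      key : Fin n → Fin m → Fin m → Carrier
      key u a b = Φ.from (phase u) (E.to b - E.to a)

      covers : ∀ u a b → lifted (E.to (E.from (key u a b))) (u , a) ≡ (next F u , b)
      covers u a b = cong (next F u ,_) (begin
        E.from (E.to a ∙ φ ph (E.to (E.from k)))  ≡⟨ cong (λ z → E.from (E.to a ∙ φ ph z)) (E.strictlyInverseˡ k) ⟩
        E.from (E.to a ∙ φ ph k)                  ≡⟨ cong (λ z → E.from (E.to a ∙ z)) (Φ.strictlyInverseˡ ph _) ⟩
        E.from (E.to a ∙ (E.to b - E.to a))       ≡⟨ cong E.from (trans (comm _ _) (//-rightDividesˡ (E.to a) (E.to b))) ⟩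
        E.from (E.to b)                           ≡⟨ E.strictlyInverseʳ b ⟩
        b                                         ∎)
        where
        ph = phase u
        k = key u a b
        open ≡-Reasoning

      unique : ∀ u a b {c} → lifted (E.to c) (u , a) ≡ (next F u , b) → E.from (key u a b) ≡ c
      unique u a b {c} h = begin
        E.from (key u a b)                  ≡⟨ cong (E.from ∘ Φ.from ph) (x≈z//y _ _ _ solves) ⟨
        E.from (Φ.from ph (φ ph (E.to c)))  ≡⟨ cong E.from (Φ.strictlyInverseʳ ph _) ⟩
        E.from (E.to c)                     ≡⟨ E.strictlyInverseʳ c ⟩
        c                                   ∎
        where
        ph = phase u
        open ≡-Reasoning
        solves : φ ph (E.to c) ∙ E.to a ≡ E.to b
        solves = trans (comm _ _) (trans (sym (E.strictlyInverseˡ _)) (cong (E.to ∘ proj₂) h))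

liftFactorization : ∀ {t n m} .{{_ : NonZero t}} {D : Digraph (Fin n)} → CkFactorization t D →
                    (G : FiniteAbelianGroup m) {g : FiniteAbelianGroup.Carrier G} {p : ℕ} →
                    SumFamily G t g → HasOrder G g p → CkFactorization (p * t) (D ≀ K̄ m)
liftFactorization fac G φ order = factorization-lift fac λ F → Lifting.lift F G φ order

order-ε : ∀ {m} (G : FiniteAbelianGroup m) → HasOrder G (FiniteAbelianGroup.ε G) 1
order-ε G = record
  { p·g≡ε = identityʳ ε
  ; q·g≢ε = λ { (suc q) _ (s≤s ()) }
  }
  where open FiniteAbelianGroup G

zeroSumLift : ∀ {t n m} .{{_ : NonZero t}} {D : Digraph (Fin n)} → CkFactorization t D →
              (G : FiniteAbelianGroup m) → ZeroSumFamily G t → CkFactorization t (D ≀ K̄ m)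
zeroSumLift {t} fac G φ = subst (λ k → CkFactorization k _) (+-identityʳ t) (liftFactorization fac G φ (order-ε G))

-- Groups carrying zero-sum families

module Cyclic (N : ℕ) .{{_ : NonZero N}} where

  [_] : ℕ → Fin N
  [ a ] = a mod N

  toℕ-[] : ∀ a → toℕ [ a ] ≡ a % N
  toℕ-[] a = toℕ-fromℕ< _

  []-cong-% : ∀ {a b} → a % N ≡ b % N → [ a ] ≡ [ b ]
  []-cong-% {a} {b} a≡b = toℕ-injective (trans (toℕ-[] a) (trans a≡b (sym (toℕ-[] b))))

  []-toℕ : ∀ x → [ toℕ x ] ≡ x
  []-toℕ x = toℕ-injective (trans (toℕ-[] (toℕ x)) (m<n⇒m%n≡m (toℕ<n x)))

  infixl 7 _⊕_
  _⊕_ : Op₂ (Fin N)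
  x ⊕ y = [ toℕ x + toℕ y ]

  0# : Fin N
  0# = [ 0 ]

  ⊖_ : Op₁ (Fin N)
  ⊖ x = [ N ∸ toℕ x ]

  []-homo-+ : ∀ a b → [ a + b ] ≡ [ a ] ⊕ [ b ]
  []-homo-+ a b = []-cong-% (trans (%-distribˡ-+ a b N) (sym (cong₂ (λ x y → (x + y) % N) (toℕ-[] a) (toℕ-[] b))))

  ⊕-comm : ∀ x y → x ⊕ y ≡ y ⊕ x
  ⊕-comm x y = cong [_] (+-comm (toℕ x) (toℕ y))

  ⊕-assoc : ∀ x y z → x ⊕ y ⊕ z ≡ x ⊕ (y ⊕ z)
  ⊕-assoc x y z = begin
    x ⊕ y ⊕ z          ≡⟨ cong (x ⊕ y ⊕_) ([]-toℕ z) ⟨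
    [ a + b ] ⊕ [ c ]  ≡⟨ []-homo-+ (a + b) c ⟨
    [ a + b + c ]      ≡⟨ cong [_] (+-assoc a b c) ⟩
    [ a + (b + c) ]    ≡⟨ []-homo-+ a (b + c) ⟩
    [ a ] ⊕ (y ⊕ z)    ≡⟨ cong (_⊕ (y ⊕ z)) ([]-toℕ x) ⟩
    x ⊕ (y ⊕ z)        ∎
    where
    a = toℕ x; b = toℕ y; c = toℕ z
    open ≡-Reasoning

  ⊕-identityʳ : ∀ x → x ⊕ 0# ≡ x
  ⊕-identityʳ x = begin
    x ⊕ 0#             ≡⟨ cong (_⊕ 0#) ([]-toℕ x) ⟨
    [ toℕ x ] ⊕ [ 0 ]  ≡⟨ []-homo-+ (toℕ x) 0 ⟨
    [ toℕ x + 0 ]      ≡⟨ cong [_] (+-identityʳ (toℕ x)) ⟩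
    [ toℕ x ]          ≡⟨ []-toℕ x ⟩
    x                  ∎
    where open ≡-Reasoning

  ⊕-inverseʳ : ∀ x → x ⊕ ⊖ x ≡ 0#
  ⊕-inverseʳ x = begin
    x ⊕ ⊖ x                    ≡⟨ cong (_⊕ ⊖ x) ([]-toℕ x) ⟨
    [ toℕ x ] ⊕ [ N ∸ toℕ x ]  ≡⟨ []-homo-+ (toℕ x) (N ∸ toℕ x) ⟨
    [ toℕ x + (N ∸ toℕ x) ]    ≡⟨ cong [_] (m+[n∸m]≡n (<⇒≤ (toℕ<n x))) ⟩
    [ N ]                      ≡⟨ []-cong-% ([m+n]%n≡m%n 0 N) ⟩
    0#                         ∎
    where open ≡-Reasoning

  ℤ/ : FiniteAbelianGroup N
  ℤ/ = record
    { Carrier        = Fin N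
    ; _∙_            = _⊕_
    ; ε              = 0#
    ; _⁻¹            = ⊖_
    ; isAbelianGroup = record
      { isGroup = record
        { isMonoid = record
          { isSemigroup = record
            { isMagma = record { isEquivalence = isEquivalence ; ∙-cong = cong₂ _⊕_ }
            ; assoc   = ⊕-assoc
            }
          ; identity    = comm∧idʳ⇒id ⊕-comm ⊕-identityʳ
          }
        ; inverse = comm∧invʳ⇒inv ⊕-comm ⊕-inverseʳ
        ; ⁻¹-cong = cong ⊖_
        }
      ; comm = ⊕-comm
      }
    ; enumeration = ↔-refl
    }
    where open Consequences (setoid (Fin N))

  open FiniteAbelianGroup ℤ/ using (_·_)

  ·-[] : ∀ q a → q · [ a ] ≡ [ q * a ]
  ·-[] zero    a = refl
  ·-[] (suc q) a = trans (cong ([ a ] ⊕_) (·-[] q a)) (sym ([]-homo-+ a (q * a)))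

  exponent : ∀ x → N · x ≡ 0#
  exponent x = begin
    N · x              ≡⟨ cong (N ·_) ([]-toℕ x) ⟨
    N · [ toℕ x ]      ≡⟨ ·-[] N (toℕ x) ⟩
    [ N * toℕ x ]      ≡⟨ cong [_] (*-comm N (toℕ x)) ⟩
    [ 0 + toℕ x * N ]  ≡⟨ []-cong-% ([m+kn]%n≡m%n 0 (toℕ x) N) ⟩
    0#                 ∎
    where open ≡-Reasoning

  order-[1] : HasOrder ℤ/ [ 1 ] N
  order-[1] = record
    { p·g≡ε = trans (q·1≡[q] N) ([]-cong-% ([m+n]%n≡m%n 0 N))
    ; q·g≢ε = λ q 0<q q<N q·1≡0 → <-irrefl (begin
        0          ≡⟨ m<n⇒m%n≡m (>-nonZero⁻¹ N) ⟨
        0 % N      ≡⟨ toℕ-[] 0 ⟨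
        toℕ 0#     ≡⟨ cong toℕ (trans (sym q·1≡0) (q·1≡[q] q)) ⟩
        toℕ [ q ]  ≡⟨ toℕ-[] q ⟩
        q % N      ≡⟨ m<n⇒m%n≡m q<N ⟩
        q          ∎) 0<q
    }
    where
    open ≡-Reasoning
    q·1≡[q] : ∀ q → q · [ 1 ] ≡ [ q ]
    q·1≡[q] q = trans (·-[] q 1) (cong [_] (*-identityʳ q))

open Cyclic using (ℤ/)

infixr 7 _⊗_
_⊗_ : ∀ {m m′} → FiniteAbelianGroup m → FiniteAbelianGroup m′ → FiniteAbelianGroup (m * m′)
A ⊗ B = record
  { Carrier        = P.Carrier
  ; _∙_            = P._∙_
  ; ε              = P.ε
  ; _⁻¹            = P._⁻¹
  ; isAbelianGroup = SubstEquality.isAbelianGroup (≡×≡⇒≡ , ≡⇒≡×≡) P.isAbelianGroup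
  ; enumeration    = ↔-trans *↔× (A.enumeration ×-↔ B.enumeration)
  }
  where
  module A = FiniteAbelianGroup A
  module B = FiniteAbelianGroup B
  module P = AbelianGroup (DirectProduct.abelianGroup A.abelianGroup B.abelianGroup)

module _ {m m′ : ℕ} {A : FiniteAbelianGroup m} {B : FiniteAbelianGroup m′} where
  private
    module A = FiniteAbelianGroup A
    module B = FiniteAbelianGroup B
    module A⊗B = FiniteAbelianGroup (A ⊗ B)

  sum-⊗ : ∀ {k} (f : Fin k → A.Carrier) (f′ : Fin k → B.Carrier) →
          A⊗B.sum (λ i → f i , f′ i) ≡ (A.sum f , B.sum f′)
  sum-⊗ {zero}  f f′ = refl
  sum-⊗ {suc k} f f′ = cong (zip A._∙_ B._∙_ (f Fin.zero , f′ Fin.zero)) (sum-⊗ (f ∘ Fin.suc) (f′ ∘ Fin.suc))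

  _⊗ᶠ_ : ∀ {t g h} → SumFamily A t g → SumFamily B t h → SumFamily (A ⊗ B) t (g , h)
  _⊗ᶠ_ {t} φ ψ = record
    { perm     = λ i → perm φ i ×-↔ perm ψ i
    ; sum-perm = λ (x , y) → trans (sum-⊗ {t} _ _) (cong₂ _,_ (sum-perm φ x) (sum-perm ψ y))
    }
    where open SumFamily

module Families {m : ℕ} (G : FiniteAbelianGroup m) where
  open FiniteAbelianGroup G
  open SumFamily

  negation : Carrier ↔ Carrier
  negation = mk↔ₛ′ _⁻¹ _⁻¹ ⁻¹-involutive ⁻¹-involutive

  translation : Carrier → Carrier ↔ Carrier
  translation h = mk↔ₛ′ (h ∙_) (h ⁻¹ ∙_) (\\-leftDividesˡ h) (\\-leftDividesʳ h)

  emptyFamily : ZeroSumFamily G 0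
  emptyFamily = record { perm = λ _ → ↔-refl ; sum-perm = λ _ → refl }

  consPair : ∀ {t g} → SumFamily G t g → SumFamily G (2 + t) g
  consPair {t} {g} φ = record
    { perm     = λ { 0 → ↔-refl ; 1 → negation ; (suc (suc i)) → perm φ i }
    ; sum-perm = λ x → begin
        x ∙ (x ⁻¹ ∙ S x)  ≡⟨ assoc x (x ⁻¹) (S x) ⟨
        x ∙ x ⁻¹ ∙ S x    ≡⟨ cong (_∙ S x) (inverseʳ x) ⟩
        ε ∙ S x           ≡⟨ identityˡ (S x) ⟩
        S x               ≡⟨ sum-perm φ x ⟩
        g                 ∎
    }
    where
    open ≡-Reasoning
    S : Carrier → Carrier
    S x = ∑[ i < t ] Inverse.to (perm φ (toℕ i)) x

  alternatingFamily : ∀ r → ZeroSumFamily G (r * 2)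
  alternatingFamily zero    = emptyFamily
  alternatingFamily (suc r) = consPair (alternatingFamily r)

  consTriple : ∀ {t g} (α β γ : Carrier ↔ Carrier) →
               (∀ x → Inverse.to α x ∙ (Inverse.to β x ∙ Inverse.to γ x) ≡ ε) →
               SumFamily G t g → SumFamily G (3 + t) g
  consTriple {t} {g} α β γ αβγ≡ε φ = record
    { perm     = λ { 0 → α ; 1 → β ; 2 → γ ; (suc (suc (suc i))) → perm φ i }
    ; sum-perm = λ x → begin
        α.to x ∙ (β.to x ∙ (γ.to x ∙ S x))  ≡⟨ cong (α.to x ∙_) (assoc (β.to x) (γ.to x) (S x)) ⟨
        α.to x ∙ (β.to x ∙ γ.to x ∙ S x)    ≡⟨ assoc (α.to x) _ (S x) ⟨
        α.to x ∙ (β.to x ∙ γ.to x) ∙ S x    ≡⟨ cong (_∙ S x) (αβγ≡ε x) ⟩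
        ε ∙ S x                             ≡⟨ identityˡ (S x) ⟩
        S x                                 ≡⟨ sum-perm φ x ⟩
        g                                   ∎
    }
    where
    module α = Inverse α
    module β = Inverse β
    module γ = Inverse γ
    open ≡-Reasoning
    S : Carrier → Carrier
    S x = ∑[ i < t ] Inverse.to (perm φ (toℕ i)) x

  translateFamily : ∀ {t} h → ZeroSumFamily G (suc t) → SumFamily G (suc t) h
  translateFamily {t} h φ = record
    { perm     = λ { 0 → ↔-trans (perm φ 0) (translation h) ; (suc i) → perm φ (suc i) }
    ; sum-perm = λ x → trans (assoc h _ _) (trans (cong (h ∙_) (sum-perm φ x)) (identityʳ h))
    }

  module OddExponent (q : ℕ) (exponent : ∀ x → suc (q * 2) · x ≡ ε) where

    halve-double : ∀ x → suc q · x ∙ suc q · x ≡ x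
    halve-double x = begin
      suc q · x ∙ suc q · x    ≡⟨ ×-homo-+ x (suc q) (suc q) ⟨
      (suc q + suc q) · x      ≡⟨ cong (_· x) (trans (cong (suc q +_) (sym (+-identityʳ (suc q)))) (*-comm 2 (suc q))) ⟩
      (1 + suc (q * 2)) · x    ≡⟨ ×-homo-+ x 1 (suc (q * 2)) ⟩
      1 · x ∙ suc (q * 2) · x  ≡⟨ cong₂ _∙_ (×-homo-1 x) (exponent x) ⟩
      x ∙ ε                    ≡⟨ identityʳ x ⟩
      x                        ∎
      where open ≡-Reasoning

    doubling : Carrier ↔ Carrier
    doubling = mk↔ₛ′ (λ x → x ∙ x) (suc q ·_) halve-double
      (λ x → trans (×-distrib-+ x x (suc q)) (halve-double x))

    oddFamily : ∀ r → ZeroSumFamily G (3 + r * 2)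
    oddFamily r = consTriple ↔-refl ↔-refl (↔-trans doubling negation)
      (λ x → trans (sym (assoc x x ((x ∙ x) ⁻¹))) (inverseʳ (x ∙ x))) (alternatingFamily r)


klein : FiniteAbelianGroup 4
klein = ℤ/ 2 ⊗ ℤ/ 2

-- klein is the additive group of 𝔽₄ = 𝔽₂[ω] with ω² = ω + 1, and ω acts by multiplication,
-- so 1 + ω + ω² = 0 makes x, ω x, ω² x a zero-sum triple.
module Klein where
  open Cyclic 2 using (_⊕_)
  open FiniteAbelianGroup klein

  ω ω² : Carrier → Carrier
  ω  (a , b) = b , a ⊕ b
  ω² (a , b) = a ⊕ b , a

  ω-ω² : ∀ x → ω (ω² x) ≡ x
  ω-ω² = λ { (0F , 0F) → refl ; (0F , 1F) → refl ; (1F , 0F) → refl ; (1F , 1F) → refl }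

  ω²-ω : ∀ x → ω² (ω x) ≡ x
  ω²-ω = λ { (0F , 0F) → refl ; (0F , 1F) → refl ; (1F , 0F) → refl ; (1F , 1F) → refl }

  1+ω+ω²≡0 : ∀ x → x ∙ (ω x ∙ ω² x) ≡ ε
  1+ω+ω²≡0 = λ { (0F , 0F) → refl ; (0F , 1F) → refl ; (1F , 0F) → refl ; (1F , 1F) → refl }

  rotation : Carrier ↔ Carrier
  rotation = mk↔ₛ′ ω ω² ω-ω² ω²-ω

  oddFamily : ∀ r → ZeroSumFamily klein (3 + r * 2)
  oddFamily r = Families.consTriple klein ↔-refl rotation (↔-sym rotation) 1+ω+ω²≡0
    (Families.alternatingFamily klein r)

data Parity : ℕ → Set where
  even : ∀ r → Parity (r * 2)
  odd  : ∀ r → Parity (suc (r * 2))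

parity : ∀ n → Parity n
parity zero = even 0
parity (suc n) with parity n
... | even r = odd r
... | odd r  = even (suc r)

ℤ/odd : (q : ℕ) → FiniteAbelianGroup (suc (q * 2))
ℤ/odd q = ℤ/ (suc (q * 2))

oddCyclicFamily : ∀ q r → ZeroSumFamily (ℤ/odd q) (3 + r * 2)
oddCyclicFamily q = Families.OddExponent.oddFamily (ℤ/odd q) q (Cyclic.exponent (suc (q * 2)))

cyclicFamily : ∀ q t → 2 ≤ t → ZeroSumFamily (ℤ/odd q) t
cyclicFamily q t 2≤t with parity t
... | even r      = Families.alternatingFamily (ℤ/odd q) r
... | odd zero    = ⊥-elim (<-irrefl refl 2≤t)
... | odd (suc r) = oddCyclicFamily q r

klein^ : ∀ ℓ → FiniteAbelianGroup (4 ^ ℓ)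
klein^ zero    = ℤ/ 1
klein^ (suc ℓ) = klein ⊗ klein^ ℓ

kleinPowerFamily : ∀ ℓ r → ZeroSumFamily (klein^ ℓ) (3 + r * 2)
kleinPowerFamily zero    r = Families.OddExponent.oddFamily (ℤ/ 1) 0 (Cyclic.exponent 1) r
kleinPowerFamily (suc ℓ) r = Klein.oddFamily r ⊗ᶠ kleinPowerFamily ℓ r

kleinCyclicFamily : ∀ ℓ q t → 2 ≤ t → ¬ (2 ∣ t) → ZeroSumFamily (klein^ ℓ ⊗ ℤ/odd q) t
kleinCyclicFamily ℓ q t 2≤t t-odd with parity t
... | even r      = ⊥-elim (t-odd (divides r refl))
... | odd zero    = ⊥-elim (<-irrefl refl 2≤t)
... | odd (suc r) = kleinPowerFamily ℓ r ⊗ᶠ oddCyclicFamily q r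

corollary4p2 : (t : ℕ) → 3 ≤ t → {n : ℕ} (D : Digraph (Fin n)) → CkFactorization t D →
    (s : ℕ) → 3 ≤ s → ¬ (2 ∣ s) → (ℓ : ℕ) →
      CkFactorization t (D ≀ K̄ s)
      × CkFactorization (s * t) (D ≀ K̄ s)
      × (¬ (2 ∣ t) → CkFactorization t (D ≀ K̄ (4 ^ ℓ * s)))
corollary4p2 t@(suc (suc (suc _))) (s≤s (s≤s (s≤s _))) D fac s _ s-odd ℓ with parity s
... | even r = ⊥-elim (s-odd (divides r refl))
... | odd q  =
  zeroSumLift fac (ℤ/ s) φ ,
  liftFactorization fac (ℤ/ s) (Families.translateFamily (ℤ/ s) [ 1 ] φ) (Cyclic.order-[1] s) ,
  λ t-odd → zeroSumLift fac (klein^ ℓ ⊗ ℤ/ s) (kleinCyclicFamily ℓ q t 2≤t t-odd)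
  where
  open Cyclic s using ([_])
  2≤t : 2 ≤ t
  2≤t = s≤s (s≤s z≤n)
  φ : ZeroSumFamily (ℤ/ s) t
  φ = cyclicFamily q t 2≤t
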